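{- Let $\Gamma$ be a vertex-transitive graph. If there exists a strong clique in $\Gamma$, then $\Gamma$ is well-covered. Moreover, every strong clique in $\Gamma$ is a maximum clique.
   Context: All graphs are finite and simple. A clique (set of pairwise adjacent vertices) is strong if it intersects every inclusion-maximal independent set. A graph is well-covered if all its inclusion-maximal independent sets have the same size. A maximum clique is a clique of largest possible size. A graph is vertex-transitive if its automorphism group acts transitively on its vertices. -}

module Defs where

open import Data.Nat using (ℕ; _≤_)
open import Data.Bool using (Bool; true; false)
open import Data.Fin using (Fin)
open import Data.Fin.Subset using (Subset; _∈_; _⊆_; ∣_∣)
open import Data.Product using (Σ; _×_; ∃)
open import Relation.Binary.PropositionalEquality using (_≡_; _≢_)
open import Function.Bundles using (_↔_; Inverse)

record Graph (n : ℕ) : Set where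
  field
    adj   : Fin n → Fin n → Bool
    sym   : ∀ x y → adj x y ≡ adj y x
    irrefl : ∀ x → adj x x ≡ false

open Graph public

module _ {n : ℕ} (G : Graph n) where

  IsIndependent : Subset n → Set
  IsIndependent S = ∀ x y → x ∈ S → y ∈ S → adj G x y ≡ false

  IsClique : Subset n → Set
  IsClique S = ∀ x y → x ∈ S → y ∈ S → x ≢ y → adj G x y ≡ true

  IsMaximalIndependent : Subset n → Set
  IsMaximalIndependent S =
    IsIndependent S × (∀ T → IsIndependent T → S ⊆ T → T ⊆ S)

  IsStrongClique : Subset n → Set
  IsStrongClique C =
    IsClique C × (∀ I → IsMaximalIndependent I → ∃ λ x → x ∈ C × x ∈ I)

  IsWellCovered : Set
  IsWellCovered =
    ∀ I J → IsMaximalIndependent I → IsMaximalIndependent J → ∣ I ∣ ≡ ∣ J ∣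

  IsMaximumClique : Subset n → Set
  IsMaximumClique C = IsClique C × (∀ D → IsClique D → ∣ D ∣ ≤ ∣ C ∣)

  IsAutomorphism : Fin n ↔ Fin n → Set
  IsAutomorphism f =
    ∀ x y → adj G (Inverse.to f x) (Inverse.to f y) ≡ adj G x y

  IsVertexTransitive : Set
  IsVertexTransitive =
    ∀ u v → Σ (Fin n ↔ Fin n) λ f → IsAutomorphism f × Inverse.to f u ≡ v

-- Double counting over the automorphism group Aut. An automorphism σ maps maximal independent
-- sets to maximal independent sets, so a strong clique C meets σ⁻¹(I) in exactly one vertex,
-- while any clique D meets it in at most one. By vertex-transitivity exactly |Aut|/n automorphisms
-- send a given vertex c to a given vertex v, hence ∑_σ |D ∩ σ⁻¹(I)| = |D| |I| |Aut| / n.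
-- Taking D = C gives n = |C| |I| for every maximal independent set I, and for an arbitrary clique
-- |D| |I| ≤ n = |C| |I|.
module Submission where

open import Defs hiding (sym)
open import Data.Bool using (true; false; if_then_else_) renaming (_≟_ to _≟ᵇ_)
open import Data.Empty using (⊥-elim)
open import Data.Fin using (Fin; zero; suc; _≟_)
open import Data.Fin.Permutation using (Permutation′; _⟨$⟩ʳ_)
open import Data.Fin.Properties using (all?; any?)
open import Data.Fin.Subset using (Subset; _∈_; _⊆_; ∣_∣; ⁅_⁆; _∪_; _∩_; ⊥)
open import Data.Fin.Subset.Properties
  using (_∈?_; nonempty?; Empty-unique; ∣⊥∣≡0; ∣⁅x⁆∣≡1; x∈⁅x⁆; x∈⁅y⁆⇒x≡y; p⊆q⇒∣p∣≤∣q∣;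
         ∣p∩q∣≤∣p∣; ∣p∩q∣≤∣q∣; x∈p∩q⁺; x∈p∩q⁻; x∈p∪q⁺; x∈p∪q⁻; ∉⊥)
open import Data.List using (List; []; _∷_; allFin)
open import Data.List.Membership.Propositional using () renaming (_∈_ to _∈ₗ_)
open import Data.List.Membership.Propositional.Properties using (∈-allFin)
open import Data.List.Relation.Unary.Any using (here; there)
open import Data.Nat using (ℕ; zero; suc; _+_; _*_; _≤_; z≤n; NonZero; >-nonZero)
open import Data.Nat.Properties
  using (≤-refl; ≤-trans; ≤-reflexive; ≤-antisym; +-identityʳ; *-identityˡ; *-identityʳ; *-zeroʳ;
         *-assoc; +-mono-≤; *-monoʳ-≤; *-cancelʳ-≡; *-cancelʳ-≤; *-cancelˡ-≡; m*n≢0; m≤m+n; m≤n+m;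
         +-*-semiring; *-commutativeSemigroup; module ≤-Reasoning)
open import Data.Product using (_×_; ∃; _,_; proj₁; proj₂)
open import Data.Sum using (_⊎_; inj₁; inj₂)
open import Data.Vec using (Vec; []; _∷_; lookup; tabulate; map)
open import Data.Vec.Properties using (lookup∘tabulate; lookup-map; []=⇒lookup; lookup⇒[]=)
open import Function using (_∘_; id)
open import Function.Bundles using (_↔_; Inverse; Injection; mk↔ₛ′; mk⇔)
open import Function.Construct.Identity using (↔-id)
open import Function.Properties.Inverse using (↔-sym; ↔⇒↣)
open import Relation.Nullary using (Dec; yes; no; does; ¬_; contradiction)
open import Relation.Nullary.Decidable using (_×-dec_; _→-dec_; dec-true; does-⇔)
open import Relation.Binary.PropositionalEquality
open import Algebra.Properties.CommutativeSemigroup *-commutativeSemigroup using (x∙yz≈y∙xz)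
open import Algebra.Properties.Semiring.Sum +-*-semiring
  using (sum; sum-cong-≗; sum-replicate-zero; ∑-comm; sum-permute; *-distribˡ-sum)

𝟙 : ∀ {p} {P : Set p} → Dec P → ℕ
𝟙 d = if does d then 1 else 0

𝟙-cong : ∀ {p q} {P : Set p} {Q : Set q} → (P → Q) → (Q → P) →
         (p? : Dec P) (q? : Dec Q) → 𝟙 p? ≡ 𝟙 q?
𝟙-cong f g p? q? = cong (λ b → if b then 1 else 0) (does-⇔ (mk⇔ f g) p? q?)

𝟙-yes : ∀ {p} {P : Set p} (p? : Dec P) → P → 𝟙 p? ≡ 1
𝟙-yes p? p = cong (λ b → if b then 1 else 0) (dec-true p? p)

𝟙*-cong : ∀ {p} {P : Set p} (p? : Dec P) {x y} → (P → x ≡ y) → 𝟙 p? * x ≡ 𝟙 p? * y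
𝟙*-cong (yes p) x≡y = cong (_+ 0) (x≡y p)
𝟙*-cong (no _)  _   = refl

𝟙*-mono-≤ : ∀ {p} {P : Set p} (p? : Dec P) {x y} → (P → x ≤ y) → 𝟙 p? * x ≤ 𝟙 p? * y
𝟙*-mono-≤ (yes p) x≤y = +-mono-≤ (x≤y p) ≤-refl
𝟙*-mono-≤ (no _)  _   = z≤n

∑-const : ∀ n x → sum {n} (λ _ → x) ≡ n * x
∑-const zero    x = refl
∑-const (suc n) x = cong (x +_) (∑-const n x)

≤-∑ : ∀ {n} (f : Fin n → ℕ) i → f i ≤ sum f
≤-∑ f zero    = m≤m+n _ _
≤-∑ f (suc i) = ≤-trans (≤-∑ (f ∘ suc) i) (m≤n+m _ _)

∑-mono-≤ : ∀ {n} {f g : Fin n → ℕ} → (∀ i → f i ≤ g i) → sum f ≤ sum g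
∑-mono-≤ {zero}  f≤g = z≤n
∑-mono-≤ {suc n} f≤g = +-mono-≤ (f≤g zero) (∑-mono-≤ (f≤g ∘ suc))

∑-select : ∀ {n} (f : Fin n → ℕ) (u : Fin n) → sum (λ v → f v * 𝟙 (u ≟ v)) ≡ f u
∑-select {suc n} f zero = begin
  f zero * 1 + sum (λ v → f (suc v) * 0) ≡⟨ cong₂ _+_ (*-identityʳ (f zero))
                                                        (sum-cong-≗ (*-zeroʳ ∘ f ∘ suc)) ⟩
  f zero + sum {n} (λ _ → 0)             ≡⟨ cong (f zero +_) (sum-replicate-zero n) ⟩
  f zero + 0                             ≡⟨ +-identityʳ (f zero) ⟩
  f zero                                 ∎
  where open ≡-Reasoning
∑-select {suc n} f (suc u) =
  trans (cong (_+ sum (λ v → f (suc v) * 𝟙 (u ≟ v))) (*-zeroʳ (f zero))) (∑-select (f ∘ suc) u)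

k*∑a*f≡∑a*k*f : ∀ {n} k (a f : Fin n → ℕ) →
                k * sum (λ i → a i * f i) ≡ sum (λ i → a i * (k * f i))
k*∑a*f≡∑a*k*f k a f =
  trans (*-distribˡ-sum k (λ i → a i * f i)) (sum-cong-≗ (λ i → x∙yz≈y∙xz k (a i) (f i)))

∑𝟙∈*k≡∣p∣*k : ∀ {n} (p : Subset n) k → sum (λ x → 𝟙 (x ∈? p) * k) ≡ ∣ p ∣ * k
∑𝟙∈*k≡∣p∣*k []          k = refl
∑𝟙∈*k≡∣p∣*k (true  ∷ p) k = cong₂ _+_ (+-identityʳ k) (∑𝟙∈*k≡∣p∣*k p k)
∑𝟙∈*k≡∣p∣*k (false ∷ p) k = ∑𝟙∈*k≡∣p∣*k p k

∣p∩q∣≡∑𝟙∈*𝟙∈ : ∀ {n} (p q : Subset n) → ∣ p ∩ q ∣ ≡ sum (λ x → 𝟙 (x ∈? p) * 𝟙 (x ∈? q))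
∣p∩q∣≡∑𝟙∈*𝟙∈ []          []          = refl
∣p∩q∣≡∑𝟙∈*𝟙∈ (true  ∷ p) (true  ∷ q) = cong suc (∣p∩q∣≡∑𝟙∈*𝟙∈ p q)
∣p∩q∣≡∑𝟙∈*𝟙∈ (true  ∷ p) (false ∷ q) = ∣p∩q∣≡∑𝟙∈*𝟙∈ p q
∣p∩q∣≡∑𝟙∈*𝟙∈ (false ∷ p) (_     ∷ q) = ∣p∩q∣≡∑𝟙∈*𝟙∈ p q

∣p∣≤1 : ∀ {n} (p : Subset n) → (∀ {x y} → x ∈ p → y ∈ p → x ≡ y) → ∣ p ∣ ≤ 1
∣p∣≤1 {n} p unique with nonempty? p
... | yes (x , x∈p) = ≤-trans (p⊆q⇒∣p∣≤∣q∣ p⊆⁅x⁆) (≤-reflexive (∣⁅x⁆∣≡1 x))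
  where
  p⊆⁅x⁆ : p ⊆ ⁅ x ⁆
  p⊆⁅x⁆ y∈p = subst (_∈ ⁅ x ⁆) (unique x∈p y∈p) (x∈⁅x⁆ x)
... | no empty = subst (_≤ 1) (sym (trans (cong ∣_∣ (Empty-unique empty)) (∣⊥∣≡0 n))) z≤n

x∈p⇒1≤∣p∣ : ∀ {n} {p : Subset n} {x} → x ∈ p → 1 ≤ ∣ p ∣
x∈p⇒1≤∣p∣ {p = p} {x} x∈p = subst (_≤ ∣ p ∣) (∣⁅x⁆∣≡1 x) (p⊆q⇒∣p∣≤∣q∣ ⁅x⁆⊆p)
  where
  ⁅x⁆⊆p : ⁅ x ⁆ ⊆ p
  ⁅x⁆⊆p y∈⁅x⁆ = subst (_∈ p) (sym (x∈⁅y⁆⇒x≡y x y∈⁅x⁆)) x∈p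

preimage : ∀ {m n} → (Fin m → Fin n) → Subset n → Subset m
preimage f p = tabulate (λ x → does (f x ∈? p))

∈-preimage⁺ : ∀ {m n} (f : Fin m → Fin n) {p x} → f x ∈ p → x ∈ preimage f p
∈-preimage⁺ f {p} {x} fx∈p =
  lookup⇒[]= x _ (trans (lookup∘tabulate _ x) (dec-true (f x ∈? p) fx∈p))

∈-preimage⁻ : ∀ {m n} (f : Fin m → Fin n) {p x} → x ∈ preimage f p → f x ∈ p
∈-preimage⁻ f {p} {x} x∈ with f x ∈? p | lookup∘tabulate (λ y → does (f y ∈? p)) x
... | yes fx∈p | _  = fx∈p
... | no _     | eq = contradiction (trans (sym ([]=⇒lookup x∈)) eq) λ ()

𝟙∈preimage : ∀ {m n} (f : Fin m → Fin n) p x → 𝟙 (x ∈? preimage f p) ≡ 𝟙 (f x ∈? p)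
𝟙∈preimage f p x = 𝟙-cong (∈-preimage⁻ f) (∈-preimage⁺ f) (x ∈? preimage f p) (f x ∈? p)

∑Vec : ∀ {m} k → (Vec (Fin m) k → ℕ) → ℕ
∑Vec zero    f = f []
∑Vec (suc k) f = sum (λ i → ∑Vec k (λ v → f (i ∷ v)))

module _ {m : ℕ} where

  ∑Vec-cong : ∀ k {f g : Vec (Fin m) k → ℕ} → (∀ v → f v ≡ g v) → ∑Vec k f ≡ ∑Vec k g
  ∑Vec-cong zero    f≗g = f≗g []
  ∑Vec-cong (suc k) f≗g = sum-cong-≗ (λ i → ∑Vec-cong k (λ v → f≗g (i ∷ v)))

  ∑Vec-mono-≤ : ∀ k {f g : Vec (Fin m) k → ℕ} → (∀ v → f v ≤ g v) → ∑Vec k f ≤ ∑Vec k g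
  ∑Vec-mono-≤ zero    f≤g = f≤g []
  ∑Vec-mono-≤ (suc k) f≤g = ∑-mono-≤ (λ i → ∑Vec-mono-≤ k (λ v → f≤g (i ∷ v)))

  ≤-∑Vec : ∀ k (f : Vec (Fin m) k → ℕ) v → f v ≤ ∑Vec k f
  ≤-∑Vec zero    f []      = ≤-refl
  ≤-∑Vec (suc k) f (i ∷ v) =
    ≤-trans (≤-∑Vec k (λ w → f (i ∷ w)) v) (≤-∑ (λ j → ∑Vec k (λ w → f (j ∷ w))) i)

  *-distribˡ-∑Vec : ∀ k x (f : Vec (Fin m) k → ℕ) → x * ∑Vec k f ≡ ∑Vec k (λ v → x * f v)
  *-distribˡ-∑Vec zero    x f = refl
  *-distribˡ-∑Vec (suc k) x f =
    trans (*-distribˡ-sum x (λ i → ∑Vec k (λ v → f (i ∷ v))))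
          (sum-cong-≗ (λ i → *-distribˡ-∑Vec k x (λ v → f (i ∷ v))))

  ∑Vec-comm-∑ : ∀ {n} k (f : Vec (Fin m) k → Fin n → ℕ) →
                ∑Vec k (λ v → sum (f v)) ≡ sum (λ i → ∑Vec k (λ v → f v i))
  ∑Vec-comm-∑ zero    f = refl
  ∑Vec-comm-∑ (suc k) f =
    trans (sum-cong-≗ (λ j → ∑Vec-comm-∑ k (λ v → f (j ∷ v))))
          (∑-comm (λ j i → ∑Vec k (λ v → f (j ∷ v) i)))

  ∑Vec-permute : ∀ k (π : Permutation′ m) (f : Vec (Fin m) k → ℕ) →
                 ∑Vec k (λ v → f (map (π ⟨$⟩ʳ_) v)) ≡ ∑Vec k f
  ∑Vec-permute zero    π f = refl
  ∑Vec-permute (suc k) π f =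
    trans (sum-cong-≗ (λ i → ∑Vec-permute k π (λ v → f ((π ⟨$⟩ʳ i) ∷ v))))
          (sym (sum-permute (λ i → ∑Vec k (λ v → f (i ∷ v))) π))

module _ {n : ℕ} (G : Graph n) where

  ∣clique∩independent∣≤1 : ∀ {C I} → IsClique G C → IsIndependent G I → ∣ C ∩ I ∣ ≤ 1
  ∣clique∩independent∣≤1 {C} {I} clique independent = ∣p∣≤1 (C ∩ I) unique
    where
    unique : ∀ {x y} → x ∈ C ∩ I → y ∈ C ∩ I → x ≡ y
    unique {x} {y} x∈C∩I y∈C∩I with x ≟ y | x∈p∩q⁻ C I x∈C∩I | x∈p∩q⁻ C I y∈C∩I
    ... | yes x≡y | _ | _ = x≡y
    ... | no x≢y | x∈C , x∈I | y∈C , y∈I =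
      contradiction (trans (sym (clique x y x∈C y∈C x≢y)) (independent x y x∈I y∈I)) λ ()

  ∣strong∩maximalIndependent∣≡1 : ∀ {C I} → IsStrongClique G C → IsMaximalIndependent G I →
                                  ∣ C ∩ I ∣ ≡ 1
  ∣strong∩maximalIndependent∣≡1 (clique , meets) maximal@(independent , _)
    with x , x∈C , x∈I ← meets _ maximal =
    ≤-antisym (∣clique∩independent∣≤1 clique independent) (x∈p⇒1≤∣p∣ (x∈p∩q⁺ (x∈C , x∈I)))

  strong-maximal-nonempty : ∀ {C I} → IsStrongClique G C → IsMaximalIndependent G I →
                            1 ≤ ∣ C ∣ × 1 ≤ ∣ I ∣
  strong-maximal-nonempty {C} {I} strong maximal =
    ≤-trans 1≤∣C∩I∣ (∣p∩q∣≤∣p∣ C I) , ≤-trans 1≤∣C∩I∣ (∣p∩q∣≤∣q∣ C I)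
    where
    1≤∣C∩I∣ : 1 ≤ ∣ C ∩ I ∣
    1≤∣C∩I∣ = ≤-reflexive (sym (∣strong∩maximalIndependent∣≡1 strong maximal))

  preimage-independent : ∀ {f I} → (∀ x y → adj G (f x) (f y) ≡ adj G x y) →
                         IsIndependent G I → IsIndependent G (preimage f I)
  preimage-independent {f} preserves independent x y x∈ y∈ =
    trans (sym (preserves x y)) (independent _ _ (∈-preimage⁻ f x∈) (∈-preimage⁻ f y∈))

  ↔-sym-isAutomorphism : ∀ {τ} → IsAutomorphism G τ → IsAutomorphism G (↔-sym τ)
  ↔-sym-isAutomorphism {τ} aut x y =
    trans (sym (aut (from x) (from y))) (cong₂ (adj G) (strictlyInverseˡ x) (strictlyInverseˡ y))
    where open Inverse τ

  preimage-maximalIndependent : ∀ {τ I} → IsAutomorphism G τ → IsMaximalIndependent G I →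
                                IsMaximalIndependent G (preimage (Inverse.to τ) I)
  preimage-maximalIndependent {τ} {I} aut (independent , maximal) =
    preimage-independent aut independent , maximal′
    where
    open Inverse τ
    maximal′ : ∀ T → IsIndependent G T → preimage to I ⊆ T → T ⊆ preimage to I
    maximal′ T independentT I′⊆T {x} x∈T =
      ∈-preimage⁺ to (T′⊆I (∈-preimage⁺ from (subst (_∈ T) (sym (strictlyInverseʳ x)) x∈T)))
      where
      T′⊆I : preimage from T ⊆ I
      T′⊆I = maximal _ (preimage-independent {from} (↔-sym-isAutomorphism {τ} aut) independentT)
        λ {y} y∈I → ∈-preimage⁺ from (I′⊆T (∈-preimage⁺ to
                      (subst (_∈ I) (sym (strictlyInverseˡ y)) y∈I)))

  -- Greedy construction of a maximal independent set

  NoNeighbourIn : Fin n → Subset n → Set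
  NoNeighbourIn x S = ∀ y → y ∈ S → adj G x y ≡ false

  noNeighbourIn? : ∀ x S → Dec (NoNeighbourIn x S)
  noNeighbourIn? x S = all? (λ y → (y ∈? S) →-dec (adj G x y ≟ᵇ false))

  -- Stated negatively so that the greedy step never has to exhibit a neighbour.
  Dominated : Subset n → Fin n → Set
  Dominated S x = x ∈ S ⊎ ¬ NoNeighbourIn x S

  insertIfFree : ∀ x S → Dec (NoNeighbourIn x S) → Subset n
  insertIfFree x S (yes _) = ⁅ x ⁆ ∪ S
  insertIfFree x S (no _)  = S

  ⁅x⁆∪-independent : ∀ {x S} → NoNeighbourIn x S → IsIndependent G S →
                     IsIndependent G (⁅ x ⁆ ∪ S)
  ⁅x⁆∪-independent {x} {S} free independent y z y∈ z∈
    with x∈p∪q⁻ ⁅ x ⁆ S y∈ | x∈p∪q⁻ ⁅ x ⁆ S z∈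
  ... | inj₁ y∈⁅x⁆ | inj₁ z∈⁅x⁆ rewrite x∈⁅y⁆⇒x≡y x y∈⁅x⁆ | x∈⁅y⁆⇒x≡y x z∈⁅x⁆ = irrefl G x
  ... | inj₁ y∈⁅x⁆ | inj₂ z∈S   rewrite x∈⁅y⁆⇒x≡y x y∈⁅x⁆ = free z z∈S
  ... | inj₂ y∈S   | inj₁ z∈⁅x⁆ rewrite x∈⁅y⁆⇒x≡y x z∈⁅x⁆ = trans (Graph.sym G y x) (free y y∈S)
  ... | inj₂ y∈S   | inj₂ z∈S   = independent y z y∈S z∈S

  insertIfFree-independent : ∀ {x S} free? → IsIndependent G S →
                             IsIndependent G (insertIfFree x S free?)
  insertIfFree-independent (yes free) = ⁅x⁆∪-independent free
  insertIfFree-independent (no _)     = id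

  ⊆-insertIfFree : ∀ {x S} free? → S ⊆ insertIfFree x S free?
  ⊆-insertIfFree (yes _) y∈S = x∈p∪q⁺ (inj₂ y∈S)
  ⊆-insertIfFree (no _)  y∈S = y∈S

  insertIfFree-dominated : ∀ {x S} free? → Dominated (insertIfFree x S free?) x
  insertIfFree-dominated {x} (yes _) = inj₁ (x∈p∪q⁺ (inj₁ (x∈⁅x⁆ x)))
  insertIfFree-dominated     (no busy) = inj₂ busy

  dominated-mono : ∀ {S T x} → S ⊆ T → Dominated S x → Dominated T x
  dominated-mono S⊆T (inj₁ x∈S)  = inj₁ (S⊆T x∈S)
  dominated-mono S⊆T (inj₂ busy) = inj₂ λ free → busy λ y y∈S → free y (S⊆T y∈S)

  greedy : List (Fin n) → Subset n
  greedy []       = ⊥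
  greedy (x ∷ xs) = insertIfFree x (greedy xs) (noNeighbourIn? x (greedy xs))

  greedy-independent : ∀ xs → IsIndependent G (greedy xs)
  greedy-independent []       y z y∈⊥ _ = ⊥-elim (∉⊥ y∈⊥)
  greedy-independent (x ∷ xs) =
    insertIfFree-independent (noNeighbourIn? x (greedy xs)) (greedy-independent xs)

  greedy-dominated : ∀ {x} xs → x ∈ₗ xs → Dominated (greedy xs) x
  greedy-dominated (x ∷ xs) (here refl)  = insertIfFree-dominated (noNeighbourIn? x (greedy xs))
  greedy-dominated (y ∷ xs) (there x∈xs) =
    dominated-mono (⊆-insertIfFree (noNeighbourIn? y (greedy xs))) (greedy-dominated xs x∈xs)

  dominating-independent⇒maximal : ∀ {S} → IsIndependent G S → (∀ x → Dominated S x) →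
                                   IsMaximalIndependent G S
  dominating-independent⇒maximal {S} independent dominated = independent , maximal
    where
    maximal : ∀ T → IsIndependent G T → S ⊆ T → T ⊆ S
    maximal T independentT S⊆T {x} x∈T with dominated x
    ... | inj₁ x∈S  = x∈S
    ... | inj₂ busy = ⊥-elim (busy λ y y∈S → independentT x y x∈T (S⊆T y∈S))

  maximalIndependent-exists : ∃ (IsMaximalIndependent G)
  maximalIndependent-exists =
    greedy (allFin n) ,
    dominating-independent⇒maximal (greedy-independent (allFin n))
                                   (λ x → greedy-dominated (allFin n) (∈-allFin x))

  -- Counting automorphisms

  -- Aut is made enumerable by representing maps by their lookup tables σ : Vec (Fin n) n.
  IsAutomorphicMap : (Fin n → Fin n) → Set
  IsAutomorphicMap f = (∀ x y → adj G (f x) (f y) ≡ adj G x y)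
                     × (∀ x y → f x ≡ f y → x ≡ y)
                     × (∀ y → ∃ λ x → f x ≡ y)

  isAutomorphicMap? : ∀ f → Dec (IsAutomorphicMap f)
  isAutomorphicMap? f =
    all? (λ x → all? λ y → adj G (f x) (f y) ≟ᵇ adj G x y) ×-dec
    all? (λ x → all? λ y → (f x ≟ f y) →-dec (x ≟ y)) ×-dec
    all? (λ y → any? λ x → f x ≟ y)

  toAutomorphism : ∀ {f} → IsAutomorphicMap f → Fin n ↔ Fin n
  toAutomorphism {f} (_ , injective , surjective) =
    mk↔ₛ′ f (proj₁ ∘ surjective) (proj₂ ∘ surjective)
          (λ x → injective _ _ (proj₂ (surjective (f x))))

  isAutomorphicMap-∘ : ∀ {τ f g} → IsAutomorphism G τ → (∀ x → g x ≡ Inverse.to τ (f x)) →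
                       IsAutomorphicMap f → IsAutomorphicMap g
  isAutomorphicMap-∘ {τ} {f} {g} aut g≗τ∘f (preserves , injective , surjective) =
    (λ x y → trans (cong₂ (adj G) (g≗τ∘f x) (g≗τ∘f y)) (trans (aut (f x) (f y)) (preserves x y))) ,
    (λ x y gx≡gy → injective x y
      (Injection.injective (↔⇒↣ τ) (trans (sym (g≗τ∘f x)) (trans gx≡gy (g≗τ∘f y))))) ,
    λ y → let x , fx≡τ⁻¹y = surjective (from y) in
          x , trans (g≗τ∘f x) (trans (cong to fx≡τ⁻¹y) (strictlyInverseˡ y))
    where open Inverse τ

  ∑Aut : (Vec (Fin n) n → ℕ) → ℕ
  ∑Aut f = ∑Vec n (λ σ → 𝟙 (isAutomorphicMap? (lookup σ)) * f σ)

  #Aut : ℕ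
  #Aut = ∑Aut (λ _ → 1)

  ∑Aut-cong : ∀ {f g} → (∀ σ → IsAutomorphicMap (lookup σ) → f σ ≡ g σ) → ∑Aut f ≡ ∑Aut g
  ∑Aut-cong f≗g = ∑Vec-cong n (λ σ → 𝟙*-cong (isAutomorphicMap? (lookup σ)) (f≗g σ))

  ∑Aut-mono-≤ : ∀ {f g} → (∀ σ → IsAutomorphicMap (lookup σ) → f σ ≤ g σ) → ∑Aut f ≤ ∑Aut g
  ∑Aut-mono-≤ f≤g = ∑Vec-mono-≤ n (λ σ → 𝟙*-mono-≤ (isAutomorphicMap? (lookup σ)) (f≤g σ))

  ∑Aut-* : ∀ k f → ∑Aut (λ σ → k * f σ) ≡ k * ∑Aut f
  ∑Aut-* k f = trans (∑Vec-cong n (λ σ → x∙yz≈y∙xz (𝟙 (isAutomorphicMap? (lookup σ))) k (f σ)))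
                     (sym (*-distribˡ-∑Vec n k (λ σ → 𝟙 (isAutomorphicMap? (lookup σ)) * f σ)))

  ∑Aut-∑ : ∀ {m} (f : Vec (Fin n) n → Fin m → ℕ) →
           ∑Aut (λ σ → sum (f σ)) ≡ sum (λ i → ∑Aut (λ σ → f σ i))
  ∑Aut-∑ f = trans (∑Vec-cong n (λ σ → *-distribˡ-sum (𝟙 (isAutomorphicMap? (lookup σ))) (f σ)))
                   (∑Vec-comm-∑ n (λ σ i → 𝟙 (isAutomorphicMap? (lookup σ)) * f σ i))

  ∑Aut-∘ : ∀ {τ} → IsAutomorphism G τ → (f : Vec (Fin n) n → ℕ) →
           ∑Aut (λ σ → f (map (Inverse.to τ) σ)) ≡ ∑Aut f
  ∑Aut-∘ {τ} aut f =
    trans (∑Vec-cong n λ σ → cong (_* f (map to σ))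
            (𝟙-cong (⇒τσ σ) (τσ⇒ σ) (isAutomorphicMap? (lookup σ))
                                     (isAutomorphicMap? (lookup (map to σ)))))
          (∑Vec-permute n τ (λ σ → 𝟙 (isAutomorphicMap? (lookup σ)) * f σ))
    where
    open Inverse τ
    ⇒τσ : ∀ σ → IsAutomorphicMap (lookup σ) → IsAutomorphicMap (lookup (map to σ))
    ⇒τσ σ = isAutomorphicMap-∘ {τ} aut (λ x → lookup-map x to σ)
    τσ⇒ : ∀ σ → IsAutomorphicMap (lookup (map to σ)) → IsAutomorphicMap (lookup σ)
    τσ⇒ σ = isAutomorphicMap-∘ {↔-sym τ} (↔-sym-isAutomorphism {τ} aut)
      (λ x → sym (trans (cong from (lookup-map x to σ)) (strictlyInverseʳ (lookup σ x))))

  1≤#Aut : 1 ≤ #Aut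
  1≤#Aut = subst (_≤ #Aut) (trans (*-identityʳ _) (𝟙-yes (isAutomorphicMap? (lookup σ₀)) identity))
                 (≤-∑Vec n _ σ₀)
    where
    σ₀ : Vec (Fin n) n
    σ₀ = tabulate id
    identity : IsAutomorphicMap (lookup σ₀)
    identity = isAutomorphicMap-∘ {↔-id (Fin n)} (λ _ _ → refl) (lookup∘tabulate id)
                 ((λ _ _ → refl) , (λ _ _ → id) , (_, refl))

  module _ (transitive : IsVertexTransitive G) where

    -- The number of automorphisms sending c to v does not depend on v (compose with an
    -- automorphism moving v to v′), and these numbers add up to #Aut.
    n*∑Aut[σc≡v]≡#Aut : ∀ c v → n * ∑Aut (λ σ → 𝟙 (lookup σ c ≟ v)) ≡ #Aut
    n*∑Aut[σc≡v]≡#Aut c v = begin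
      n * N v                                           ≡⟨ ∑-const n (N v) ⟨
      sum {n} (λ _ → N v)                               ≡⟨ sum-cong-≗ (N-uniform v) ⟩
      sum N                                             ≡⟨ ∑Aut-∑ (λ σ v′ → 𝟙 (lookup σ c ≟ v′)) ⟨
      ∑Aut (λ σ → sum (λ v′ → 𝟙 (lookup σ c ≟ v′)))    ≡⟨ ∑Aut-cong (λ σ _ → ∑𝟙≟≡1 (lookup σ c)) ⟩
      #Aut                                              ∎
      where
      open ≡-Reasoning
      N : Fin n → ℕ
      N v = ∑Aut (λ σ → 𝟙 (lookup σ c ≟ v))
      ∑𝟙≟≡1 : ∀ u → sum (λ v → 𝟙 (u ≟ v)) ≡ 1
      ∑𝟙≟≡1 u = trans (sum-cong-≗ (λ v → sym (*-identityˡ (𝟙 (u ≟ v))))) (∑-select (λ _ → 1) u)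
      N-uniform : ∀ v v′ → N v ≡ N v′
      N-uniform v v′ with τ , aut , τv≡v′ ← transitive v v′ =
        trans (∑Aut-cong (λ σ _ →
                𝟙-cong (σc≡v⇒ σ) (⇒σc≡v σ) (lookup σ c ≟ v) (lookup (map to σ) c ≟ v′)))
              (∑Aut-∘ {τ} aut (λ σ → 𝟙 (lookup σ c ≟ v′)))
        where
        open Inverse τ
        σc≡v⇒ : ∀ σ → lookup σ c ≡ v → lookup (map to σ) c ≡ v′
        σc≡v⇒ σ σc≡v = trans (lookup-map c to σ) (trans (cong to σc≡v) τv≡v′)
        ⇒σc≡v : ∀ σ → lookup (map to σ) c ≡ v′ → lookup σ c ≡ v
        ⇒σc≡v σ τσc≡v′ =
          Injection.injective (↔⇒↣ τ) (trans (sym (lookup-map c to σ)) (trans τσc≡v′ (sym τv≡v′)))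

    n*∑Aut[σc∈I]≡∣I∣*#Aut : ∀ c I → n * ∑Aut (λ σ → 𝟙 (lookup σ c ∈? I)) ≡ ∣ I ∣ * #Aut
    n*∑Aut[σc∈I]≡∣I∣*#Aut c I = begin
      n * ∑Aut (λ σ → 𝟙 (lookup σ c ∈? I))
        ≡⟨ cong (n *_) (∑Aut-cong (λ σ _ → sym (∑-select (λ v → 𝟙 (v ∈? I)) (lookup σ c)))) ⟩
      n * ∑Aut (λ σ → sum (λ v → 𝟙 (v ∈? I) * 𝟙 (lookup σ c ≟ v)))
        ≡⟨ cong (n *_) (trans (∑Aut-∑ (λ σ v → 𝟙 (v ∈? I) * 𝟙 (lookup σ c ≟ v)))
             (sum-cong-≗ (λ v → ∑Aut-* (𝟙 (v ∈? I)) (λ σ → 𝟙 (lookup σ c ≟ v))))) ⟩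
      n * sum (λ v → 𝟙 (v ∈? I) * ∑Aut (λ σ → 𝟙 (lookup σ c ≟ v)))
        ≡⟨ k*∑a*f≡∑a*k*f n (λ v → 𝟙 (v ∈? I)) (λ v → ∑Aut (λ σ → 𝟙 (lookup σ c ≟ v))) ⟩
      sum (λ v → 𝟙 (v ∈? I) * (n * ∑Aut (λ σ → 𝟙 (lookup σ c ≟ v))))
        ≡⟨ sum-cong-≗ (λ v → cong (𝟙 (v ∈? I) *_) (n*∑Aut[σc≡v]≡#Aut c v)) ⟩
      sum (λ v → 𝟙 (v ∈? I) * #Aut)
        ≡⟨ ∑𝟙∈*k≡∣p∣*k I #Aut ⟩
      ∣ I ∣ * #Aut ∎
      where open ≡-Reasoning

    n*∑Aut∣D∩σ⁻¹I∣≡∣D∣*∣I∣*#Aut : ∀ D I →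
      n * ∑Aut (λ σ → ∣ D ∩ preimage (lookup σ) I ∣) ≡ ∣ D ∣ * (∣ I ∣ * #Aut)
    n*∑Aut∣D∩σ⁻¹I∣≡∣D∣*∣I∣*#Aut D I = begin
      n * ∑Aut (λ σ → ∣ D ∩ preimage (lookup σ) I ∣)
        ≡⟨ cong (n *_) (∑Aut-cong (λ σ _ → trans (∣p∩q∣≡∑𝟙∈*𝟙∈ D (preimage (lookup σ) I))
             (sum-cong-≗ (λ c → cong (𝟙 (c ∈? D) *_) (𝟙∈preimage (lookup σ) I c))))) ⟩
      n * ∑Aut (λ σ → sum (λ c → 𝟙 (c ∈? D) * 𝟙 (lookup σ c ∈? I)))
        ≡⟨ cong (n *_) (trans (∑Aut-∑ (λ σ c → 𝟙 (c ∈? D) * 𝟙 (lookup σ c ∈? I)))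
             (sum-cong-≗ (λ c → ∑Aut-* (𝟙 (c ∈? D)) (λ σ → 𝟙 (lookup σ c ∈? I))))) ⟩
      n * sum (λ c → 𝟙 (c ∈? D) * ∑Aut (λ σ → 𝟙 (lookup σ c ∈? I)))
        ≡⟨ k*∑a*f≡∑a*k*f n (λ c → 𝟙 (c ∈? D)) (λ c → ∑Aut (λ σ → 𝟙 (lookup σ c ∈? I))) ⟩
      sum (λ c → 𝟙 (c ∈? D) * (n * ∑Aut (λ σ → 𝟙 (lookup σ c ∈? I))))
        ≡⟨ sum-cong-≗ (λ c → cong (𝟙 (c ∈? D) *_) (n*∑Aut[σc∈I]≡∣I∣*#Aut c I)) ⟩
      sum (λ c → 𝟙 (c ∈? D) * (∣ I ∣ * #Aut))
        ≡⟨ ∑𝟙∈*k≡∣p∣*k D (∣ I ∣ * #Aut) ⟩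
      ∣ D ∣ * (∣ I ∣ * #Aut) ∎
      where open ≡-Reasoning

    n*#Aut≡∣C∣*∣I∣*#Aut : ∀ {C I} → IsStrongClique G C → IsMaximalIndependent G I →
                           n * #Aut ≡ ∣ C ∣ * (∣ I ∣ * #Aut)
    n*#Aut≡∣C∣*∣I∣*#Aut {C} {I} strong maximal =
      trans (cong (n *_) (∑Aut-cong meetsOnce)) (n*∑Aut∣D∩σ⁻¹I∣≡∣D∣*∣I∣*#Aut C I)
      where
      meetsOnce : ∀ σ → IsAutomorphicMap (lookup σ) → 1 ≡ ∣ C ∩ preimage (lookup σ) I ∣
      meetsOnce σ automorphic = sym (∣strong∩maximalIndependent∣≡1 strong
        (preimage-maximalIndependent {toAutomorphism automorphic} (proj₁ automorphic) maximal))

    n≡∣C∣*∣I∣ : ∀ {C I} → IsStrongClique G C → IsMaximalIndependent G I → n ≡ ∣ C ∣ * ∣ I ∣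
    n≡∣C∣*∣I∣ {C} {I} strong maximal = *-cancelʳ-≡ n (∣ C ∣ * ∣ I ∣) #Aut {{>-nonZero 1≤#Aut}}
      (trans (n*#Aut≡∣C∣*∣I∣*#Aut strong maximal) (sym (*-assoc (∣ C ∣) (∣ I ∣) #Aut)))

    ∣clique∣≤∣strongClique∣ : ∀ {C D I} → IsStrongClique G C → IsClique G D →
                              IsMaximalIndependent G I → ∣ D ∣ ≤ ∣ C ∣
    ∣clique∣≤∣strongClique∣ {C} {D} {I} strong clique maximal =
      *-cancelʳ-≤ (∣ D ∣) (∣ C ∣) (∣ I ∣ * #Aut) {{∣I∣*#Aut≢0}} (begin
        ∣ D ∣ * (∣ I ∣ * #Aut)
          ≡⟨ n*∑Aut∣D∩σ⁻¹I∣≡∣D∣*∣I∣*#Aut D I ⟨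
        n * ∑Aut (λ σ → ∣ D ∩ preimage (lookup σ) I ∣)
          ≤⟨ *-monoʳ-≤ n (∑Aut-mono-≤ meetsAtMostOnce) ⟩
        n * #Aut
          ≡⟨ n*#Aut≡∣C∣*∣I∣*#Aut strong maximal ⟩
        ∣ C ∣ * (∣ I ∣ * #Aut) ∎)
      where
      open ≤-Reasoning
      ∣I∣*#Aut≢0 : NonZero (∣ I ∣ * #Aut)
      ∣I∣*#Aut≢0 = m*n≢0 (∣ I ∣) #Aut {{>-nonZero (proj₂ (strong-maximal-nonempty strong maximal))}}
                                      {{>-nonZero 1≤#Aut}}
      meetsAtMostOnce : ∀ σ → IsAutomorphicMap (lookup σ) → ∣ D ∩ preimage (lookup σ) I ∣ ≤ 1
      meetsAtMostOnce σ (preserves , _) =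
        ∣clique∩independent∣≤1 clique (preimage-independent preserves (proj₁ maximal))

corollary3p2 : (n : ℕ) (G : Graph n) → IsVertexTransitive G →
    ((∃ λ C → IsStrongClique G C) → IsWellCovered G) ×
    (∀ (C : Subset n) → IsStrongClique G C → IsMaximumClique G C)
corollary3p2 n G transitive = wellCovered , maximum
  where
  wellCovered : (∃ λ C → IsStrongClique G C) → IsWellCovered G
  wellCovered (C , strong) I J maxI maxJ =
    *-cancelˡ-≡ (∣ I ∣) (∣ J ∣) (∣ C ∣) {{∣C∣≢0}}
      (trans (sym (n≡∣C∣*∣I∣ G transitive strong maxI)) (n≡∣C∣*∣I∣ G transitive strong maxJ))
    where
    ∣C∣≢0 : NonZero ∣ C ∣
    ∣C∣≢0 = >-nonZero (proj₁ (strong-maximal-nonempty G strong maxI))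

  maximum : ∀ C → IsStrongClique G C → IsMaximumClique G C
  maximum C strong = proj₁ strong , λ D clique →
    ∣clique∣≤∣strongClique∣ G transitive strong clique (proj₂ (maximalIndependent-exists G))
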